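{- Let $M$ and $M'$ be $0/\pm1$ matrices such that $M'$ can be obtained from $M$ by permuting its rows and its columns. Then the posets $(\mathrm{Part}(M),\preceq)$ and $(\mathrm{Part}(M'),\preceq)$ are isomorphic.
   Context: For a matrix $P$ and integers $a\le b$, $c\le d$, $P_{[a,b)\times[c,d)}$ denotes the (possibly empty) submatrix of rows $a,\dots,b-1$ and columns $c,\dots,d-1$. A submatrix of a permutation matrix is increasing if its nonzero entries, listed in order of increasing row index, have strictly increasing column indices, and decreasing if strictly decreasing (a zero or empty submatrix is both). For an $r\times s$ matrix $M$ with entries in $\{0,1,-1\}$ and an $n\times n$ permutation matrix $P$, an $M$-partition of $P$ is a pair of multisets $I=\{1=i_1\le\dots\le i_{r+1}=n+1\}$, $J=\{1=j_1\le\dots\le j_{s+1}=n+1\}$ such that for all $k\in[r]$, $\ell\in[s]$: $P_{[i_k,i_{k+1})\times[j_\ell,j_{\ell+1})}$ is zero if $M_{k,\ell}=0$, increasing if $M_{k,\ell}=1$, decreasing if $M_{k,\ell}=-1$. $\mathrm{Part}(M)$ is the set of triples $(P,I,J)$ with $P$ a permutation matrix and $(I,J)$ an $M$-partition of $P$. For a matrix $P$, $\mathrm{supp}(P)$ is the set of positions of nonzero entries; for a finite set $X$ of positions, $\Delta(X)$ is the smallest $0/1$ matrix with support $X$, and $\mathrm{red}(Q)$ is obtained from $Q$ by deleting all all-zero rows and columns. For $(P,I,J),(P',I',J')\in\mathrm{Part}(M)$ with $I=\{i_1\le\dots\le i_{r+1}\}$, $J=\{j_1\le\dots\le j_{s+1}\}$,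 $I'=\{i'_1\le\dots\le i'_{r+1}\}$, $J'=\{j'_1\le\dots\le j'_{s+1}\}$, write $(P',I',J')\preceq(P,I,J)$ if there is $X\subseteq\mathrm{supp}(P)$ with $\mathrm{red}(\Delta(X))=P'$ and, for all $k\in[r],\ell\in[s]$, $|X\cap([i_k,i_{k+1})\times[j_\ell,j_{\ell+1}))|=|\mathrm{supp}(P')\cap([i'_k,i'_{k+1})\times[j'_\ell,j'_{\ell+1}))|$. This $\preceq$ is a partial order on $\mathrm{Part}(M)$. -}

module Defs where

open import Data.Nat using (ℕ; zero; suc; _≤_; _<_; _+_; _≤ᵇ_; _<ᵇ_)
open import Data.Fin using (Fin; toℕ; inject₁; fromℕ) renaming (zero to fzero; suc to fsuc)
open import Data.Vec using (Vec; lookup)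
open import Data.List using (List; length)
import Data.List as L
open import Data.List.Relation.Unary.All using (All)
open import Data.List.Relation.Unary.Unique.Propositional using (Unique)
open import Data.Product using (Σ; _×_; _,_)
open import Data.Bool using (Bool; true; false; _∧_; T; if_then_else_)
open import Data.Empty using (⊥)
open import Relation.Binary.PropositionalEquality using (_≡_)
open import Function.Bundles using (_⇔_)

data Entry : Set where
  e0 e+1 e-1 : Entry

Matrix : ℕ → ℕ → Set
Matrix r s = Fin r → Fin s → Entry

-- A permutation of size n = length π, 0-indexed: row a has its unique
-- nonzero entry in column π(a).  π must be a permutation of {0,…,n-1}.
IsPerm : List ℕ → Set
IsPerm π = All (λ x → x < length π) π × Unique π

col : (π : List ℕ) → Fin (length π) → ℕ
col π a = L.lookup π a

-- x ∈ [V_k , V_{k+1})   (Bool version, so that it can be counted)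
inBlockᵇ : ∀ {t} → Vec ℕ (suc t) → Fin t → ℕ → Bool
inBlockᵇ V k x = (lookup V (inject₁ k) ≤ᵇ x) ∧ (x <ᵇ lookup V (fsuc k))

InBlock : ∀ {t} → Vec ℕ (suc t) → Fin t → ℕ → Set
InBlock V k x = T (inBlockᵇ V k x)

-- V = {0 = v_1 ≤ … ≤ v_{t+1} = n}  (0-indexed version of {1 = … = n+1})
IsSeparator : ∀ {t} → Vec ℕ (suc t) → ℕ → Set
IsSeparator {t} V n =
  (lookup V fzero ≡ 0) × (lookup V (fromℕ t) ≡ n) ×
  ((k : Fin t) → lookup V (inject₁ k) ≤ lookup V (fsuc k))

BlockOK : ∀ {r s} → Entry → (π : List ℕ) → Vec ℕ (suc r) → Vec ℕ (suc s) →
          Fin r → Fin s → Set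
BlockOK e0 π I J k l =
  (a : Fin (length π)) → InBlock I k (toℕ a) → InBlock J l (col π a) → ⊥
BlockOK e+1 π I J k l =
  (a b : Fin (length π)) → toℕ a < toℕ b →
  InBlock I k (toℕ a) → InBlock I k (toℕ b) →
  InBlock J l (col π a) → InBlock J l (col π b) → col π a < col π b
BlockOK e-1 π I J k l =
  (a b : Fin (length π)) → toℕ a < toℕ b →
  InBlock I k (toℕ a) → InBlock I k (toℕ b) →
  InBlock J l (col π a) → InBlock J l (col π b) → col π b < col π a

record Part {r s : ℕ} (M : Matrix r s) : Set where
  field
    perm    : List ℕ
    isPerm  : IsPerm perm
    I       : Vec ℕ (suc r)
    J       : Vec ℕ (suc s)
    I-sep   : IsSeparator I (length perm)
    J-sep   : IsSeparator J (length perm)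
    blocks  : (k : Fin r) (l : Fin s) → BlockOK (M k l) perm I J k l
open Part public

_≈_ : ∀ {r s} {M : Matrix r s} → Part M → Part M → Set
x ≈ y = (perm x ≡ perm y) × (I x ≡ I y) × (J x ≡ J y)

count : ∀ {m} → (Fin m → Bool) → ℕ
count {zero}  f = 0
count {suc m} f = (if f fzero then 1 else 0) + count (λ a → f (fsuc a))

StrictlyIncreasing : ∀ {m n} → (Fin m → Fin n) → Set
StrictlyIncreasing {m} e = (a b : Fin m) → toℕ a < toℕ b → toℕ (e a) < toℕ (e b)

-- A set X ⊆ supp(P) is given by its rows listed increasingly,
-- e : Fin n' → Fin n strictly increasing (X = {(e a , π(e a))}).
-- red(Δ(X)) = P' says exactly that the a-th row of X carries the
-- P'-entry of row a, i.e. the columns of X are in the same relative order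
-- as the columns of P'.
_⪯_ : ∀ {r s} {M : Matrix r s} → Part M → Part M → Set
_⪯_ {r} {s} x' x =
  Σ (Fin (length (perm x')) → Fin (length (perm x))) λ e →
    StrictlyIncreasing e ×
    ((a b : Fin (length (perm x'))) →
       (col (perm x') a < col (perm x') b) ⇔ (col (perm x) (e a) < col (perm x) (e b))) ×
    ((k : Fin r) (l : Fin s) →
       count (λ a → inBlockᵇ (I x) k (toℕ (e a)) ∧ inBlockᵇ (J x) l (col (perm x) (e a)))
       ≡ count (λ a → inBlockᵇ (I x') k (toℕ a) ∧ inBlockᵇ (J x') l (col (perm x') a)))

record PosetIso {r s r' s'} (M : Matrix r s) (M' : Matrix r' s') : Set where
  field
    to       : Part M → Part M'
    from     : Part M' → Part M
    to-cong  : ∀ {x y} → x ≈ y → to x ≈ to y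
    from-cong : ∀ {x y} → x ≈ y → from x ≈ from y
    from-to  : ∀ x → from (to x) ≈ x
    to-from  : ∀ y → to (from y) ≈ y
    to-mono  : ∀ x y → x ⪯ y → to x ⪯ to y
    to-refl  : ∀ x y → to x ⪯ to y → x ⪯ y

-- Permuting the rows of M by σ and its columns by τ acts on Part(M): the row blocks of (P, I, J)
-- are moved rigidly into the order given by σ (I is rebuilt from the permuted block sizes), the
-- column blocks likewise by τ, and P is carried along. Each block of P lands in the block of M'
-- holding the same entry and keeps its internal order, so the result lies in Part(M');
-- rearranging by σ⁻¹ and τ⁻¹ undoes it.
-- For monotonicity, the block counts in x' ⪯ x force the embedding to keep every point in its
-- block: summing them shows that below each separator there are as many points of x' as of
-- their images, and both point sets are down-closed in the row (column) order, so they
-- coincide. The rearranged embedding then preserves the order inside each block, and across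
-- blocks both orders are dictated by the block order.
module Submission where

open import Defs
open import Data.Nat using (ℕ)
open import Data.Fin.Permutation using (Permutation′; _⟨$⟩ʳ_)
open import Relation.Binary.PropositionalEquality using (_≡_)

open import Data.Nat using (zero; suc; _+_; _∸_; _≤_; _<_; _≤ᵇ_; _<ᵇ_; z≤n; s≤s; z<s; s<s; s≤s⁻¹)
open import Data.Nat.Properties hiding (_≟_)
open import Data.Fin using (Fin; toℕ; inject₁; fromℕ; fromℕ<; cast; _≟_) renaming (zero to fzero; suc to fsuc)
open import Data.Fin.Properties using (toℕ-injective; toℕ<n; toℕ-fromℕ<; toℕ-inject₁; toℕ-cast; fromℕ<-toℕ; toℕ-fromℕ; cast-involutive; cast-is-id; any?)
open import Data.Fin.Permutation using (_⟨$⟩ˡ_; inverseˡ; inverseʳ; flip)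
open import Data.Vec using (Vec; lookup; []; _∷_)
import Data.Vec as V
open import Data.List using (List; length)
import Data.List as L
import Data.List.Properties as LP
import Data.List.Relation.Unary.All as All
import Data.List.Relation.Unary.All.Properties as AllP
open import Data.List.Relation.Unary.AllPairs using (_∷_)
open import Data.List.Relation.Unary.Unique.Propositional using (Unique)
import Data.List.Relation.Unary.Unique.Propositional.Properties as UniqueP
open import Data.List.Membership.Propositional.Properties using (∈-lookup)
open import Data.Product using (Σ; _×_; _,_; proj₁; proj₂)
open import Data.Sum using (inj₁; inj₂)
open import Data.Bool using (Bool; true; false; _∧_; not; T)
open import Data.Bool.Properties using (∧-comm; ∧-assoc; ∧-identityʳ; T-≡)
open import Data.Unit using (tt)
open import Data.Empty using (⊥; ⊥-elim)
open import Relation.Nullary using (yes; no)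
open import Relation.Nullary.Decidable using (T?)
open import Relation.Binary.PropositionalEquality using (refl; sym; trans; cong; cong₂; subst; subst₂; module ≡-Reasoning)
open import Relation.Binary.Definitions using (tri<; tri≈; tri>)
open import Function using (_∘_; id)
open import Function.Bundles using (_⇔_; mk⇔; Equivalence)
open import Function.Properties.Equivalence using () renaming (trans to ⇔-trans; sym to ⇔-sym)
open import Algebra.Properties.CommutativeMonoid.Sum +-0-commutativeMonoid using (sum; sum-permute)

T-ext : ∀ {a b : Bool} → (T a → T b) → (T b → T a) → a ≡ b
T-ext {false} {false} _ _ = refl
T-ext {false} {true}  _ g = ⊥-elim (g tt)
T-ext {true}  {false} f _ = ⊥-elim (f tt)
T-ext {true}  {true}  _ _ = refl

∧-intro : ∀ {a b} → T a → T b → T (a ∧ b)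
∧-intro {true} {true} _ _ = tt

∧-elimˡ : ∀ {a b} → T (a ∧ b) → T a
∧-elimˡ {true} _ = tt

∧-elimʳ : ∀ {a b} → T (a ∧ b) → T b
∧-elimʳ {true} p = p

T-not : ∀ {b} → T (not b) → T b → ⊥
T-not {false} _ ()

not-T : ∀ {b} → (T b → ⊥) → T (not b)
not-T {true}  f = f tt
not-T {false} _ = tt

∧-≡ʳ : ∀ {a b} → (T b → T a) → a ∧ b ≡ b
∧-≡ʳ {true}           _ = refl
∧-≡ʳ {false} {false}  _ = refl
∧-≡ʳ {false} {true}   h = ⊥-elim (h tt)

≤ᵇ≡not<ᵇ : ∀ x y → (x ≤ᵇ y) ≡ not (y <ᵇ x)
≤ᵇ≡not<ᵇ x y = T-ext
  (λ x≤y → not-T (λ y<x → <⇒≱ (<ᵇ⇒< y x y<x) (≤ᵇ⇒≤ x y x≤y)))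
  (λ y≮x → ≤⇒≤ᵇ {x} {y} (≮⇒≥ (λ y<x → T-not {y <ᵇ x} y≮x (<⇒<ᵇ y<x))))

count-cong : ∀ {m} {f g : Fin m → Bool} → (∀ a → f a ≡ g a) → count f ≡ count g
count-cong {zero}          _ = refl
count-cong {suc m} {f} {g} e rewrite e fzero = cong (_ +_) (count-cong (e ∘ fsuc))

count-split : ∀ {m} (f g : Fin m → Bool) →
              count f ≡ count (λ a → f a ∧ g a) + count (λ a → f a ∧ not (g a))
count-split {zero}  f g = refl
count-split {suc m} f g with f fzero | g fzero
... | false | _     = count-split (f ∘ fsuc) (g ∘ fsuc)
... | true  | true  = cong suc (count-split (f ∘ fsuc) (g ∘ fsuc))
... | true  | false = trans (cong suc (count-split (f ∘ fsuc) (g ∘ fsuc))) (sym (+-suc _ _))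

count-≡0 : ∀ {m} (f : Fin m → Bool) → (∀ a → T (f a) → ⊥) → count f ≡ 0
count-≡0 {zero}  f _ = refl
count-≡0 {suc m} f h with f fzero in eq
... | false = count-≡0 (f ∘ fsuc) (h ∘ fsuc)
... | true  = ⊥-elim (h fzero (subst T (sym eq) tt))

count-mono : ∀ {m} (f g : Fin m → Bool) → (∀ a → T (f a) → T (g a)) → count f ≤ count g
count-mono {zero}  f g h = z≤n
count-mono {suc m} f g h with f fzero in ef | g fzero in eg
... | false | false = count-mono (f ∘ fsuc) (g ∘ fsuc) (h ∘ fsuc)
... | false | true  = m≤n⇒m≤1+n (count-mono (f ∘ fsuc) (g ∘ fsuc) (h ∘ fsuc))
... | true  | true  = s≤s (count-mono (f ∘ fsuc) (g ∘ fsuc) (h ∘ fsuc))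
... | true  | false = ⊥-elim (subst T eg (h fzero (subst T (sym ef) tt)))

count-monoˢ : ∀ {m} (f g : Fin m → Bool) → (∀ a → T (f a) → T (g a)) →
              (a : Fin m) → T (g a) → (T (f a) → ⊥) → count f < count g
count-monoˢ {suc m} f g h fzero ga ¬fa with f fzero in ef | g fzero in eg
... | true  | _     = ⊥-elim (¬fa tt)
... | false | false = ⊥-elim ga
... | false | true  = s≤s (count-mono (f ∘ fsuc) (g ∘ fsuc) (h ∘ fsuc))
count-monoˢ {suc m} f g h (fsuc a) ga ¬fa with f fzero in ef | g fzero in eg
... | false | false = count-monoˢ (f ∘ fsuc) (g ∘ fsuc) (h ∘ fsuc) a ga ¬fa
... | false | true  = m≤n⇒m≤1+n (count-monoˢ (f ∘ fsuc) (g ∘ fsuc) (h ∘ fsuc) a ga ¬fa)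
... | true  | true  = s≤s (count-monoˢ (f ∘ fsuc) (g ∘ fsuc) (h ∘ fsuc) a ga ¬fa)
... | true  | false = ⊥-elim (subst T eg (h fzero (subst T (sym ef) tt)))

DownClosed : ∀ {m} → (Fin m → ℕ) → (Fin m → Bool) → Set
DownClosed g P = ∀ a b → g a < g b → T (P b) → T (P a)

downClosed-count-≡⇒⊆ : ∀ {m} (g : Fin m → ℕ) → (∀ {a b} → g a ≡ g b → a ≡ b) →
                       (P Q : Fin m → Bool) → DownClosed g P → DownClosed g Q →
                       count P ≡ count Q → ∀ a → T (P a) → T (Q a)
downClosed-count-≡⇒⊆ g g-inj P Q P↓ Q↓ P≡Q a Pa with T? (Q a)
... | yes Qa = Qa
... | no ¬Qa = ⊥-elim (<-irrefl (sym P≡Q) (count-monoˢ Q P Q⊆P a Pa ¬Qa))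
  where
  Q⊆P : ∀ b → T (Q b) → T (P b)
  Q⊆P b Qb with <-cmp (g b) (g a)
  ... | tri< gb<ga _ _ = P↓ b a gb<ga Pa
  ... | tri≈ _ gb≡ga _ = ⊥-elim (¬Qa (subst (T ∘ Q) (g-inj gb≡ga) Qb))
  ... | tri> _ _ ga<gb = ⊥-elim (¬Qa (Q↓ a b ga<gb Qb))

downClosed-count-≡⇒≡ : ∀ {m} (g : Fin m → ℕ) → (∀ {a b} → g a ≡ g b → a ≡ b) →
                       (P Q : Fin m → Bool) → DownClosed g P → DownClosed g Q →
                       count P ≡ count Q → ∀ a → P a ≡ Q a
downClosed-count-≡⇒≡ g g-inj P Q P↓ Q↓ P≡Q a =
  T-ext (downClosed-count-≡⇒⊆ g g-inj P Q P↓ Q↓ P≡Q a) (downClosed-count-≡⇒⊆ g g-inj Q P Q↓ P↓ (sym P≡Q) a)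

nth : ∀ {m} → Vec ℕ m → ℕ → ℕ
nth []       _       = 0
nth (x ∷ _)  zero    = x
nth (_ ∷ xs) (suc i) = nth xs i

lookup≡nth : ∀ {m} (V : Vec ℕ m) (k : Fin m) → lookup V k ≡ nth V (toℕ k)
lookup≡nth (_ ∷ _) fzero    = refl
lookup≡nth (_ ∷ V) (fsuc k) = lookup≡nth V k

nth-map : ∀ {m} (f : ℕ → ℕ) (V : Vec ℕ m) {i} → i < m → nth (V.map f V) i ≡ f (nth V i)
nth-map f (_ ∷ _) {zero}  _         = refl
nth-map f (_ ∷ V) {suc i} (s<s i<m) = nth-map f V i<m

nth-ext : ∀ {m} (U W : Vec ℕ m) → (∀ i → i < m → nth U i ≡ nth W i) → U ≡ W
nth-ext []      []      _ = refl
nth-ext (_ ∷ U) (_ ∷ W) h = cong₂ _∷_ (h 0 z<s) (nth-ext U W (λ i → h (suc i) ∘ s<s))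

record Separator (v : ℕ → ℕ) (t n : ℕ) : Set where
  field
    first≡0 : v 0 ≡ 0
    last≡n  : v t ≡ n
    step-≤  : ∀ i → i < t → v i ≤ v (suc i)
open Separator

Between : (ℕ → ℕ) → ℕ → ℕ → Set
Between v i x = v i ≤ x × x < v (suc i)

IsSeparator⇒Separator : ∀ {t n} (V : Vec ℕ (suc t)) → IsSeparator V n → Separator (nth V) t n
IsSeparator⇒Separator {t} V (V₀≡0 , Vₜ≡n , V-step) = record
  { first≡0 = trans (sym (lookup≡nth V fzero)) V₀≡0
  ; last≡n  = trans (sym (trans (lookup≡nth V (fromℕ t)) (cong (nth V) (toℕ-fromℕ t)))) Vₜ≡n
  ; step-≤  = λ i i<t → subst₂ _≤_
      (trans (lookup≡nth V _) (cong (nth V) (trans (toℕ-inject₁ (fromℕ< i<t)) (toℕ-fromℕ< i<t))))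
      (trans (lookup≡nth V _) (cong (nth V ∘ suc) (toℕ-fromℕ< i<t)))
      (V-step (fromℕ< i<t))
  }

InBlock⇔Between : ∀ {t} (V : Vec ℕ (suc t)) (k : Fin t) x → InBlock V k x ⇔ Between (nth V) (toℕ k) x
InBlock⇔Between V k x = mk⇔
  (λ p → subst (_≤ x) lower (≤ᵇ⇒≤ _ x (∧-elimˡ p))
       , subst (x <_) upper (<ᵇ⇒< x _ (∧-elimʳ {lookup V (inject₁ k) ≤ᵇ x} p)))
  (λ (l , u) → ∧-intro (≤⇒≤ᵇ (subst (_≤ x) (sym lower) l)) (<⇒<ᵇ (subst (x <_) (sym upper) u)))
  where
  lower : lookup V (inject₁ k) ≡ nth V (toℕ k)
  lower = trans (lookup≡nth V (inject₁ k)) (cong (nth V) (toℕ-inject₁ k))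
  upper : lookup V (fsuc k) ≡ nth V (suc (toℕ k))
  upper = lookup≡nth V (fsuc k)

inBlockᵇ≡ : ∀ {t} (U : Vec ℕ (suc t)) (k : Fin t) y →
            inBlockᵇ U k y ≡ not (y <ᵇ nth U (toℕ k)) ∧ (y <ᵇ nth U (suc (toℕ k)))
inBlockᵇ≡ U k y = trans
  (cong₂ (λ u v → (u ≤ᵇ y) ∧ (y <ᵇ v))
         (trans (lookup≡nth U (inject₁ k)) (cong (nth U) (toℕ-inject₁ k))) (lookup≡nth U (fsuc k)))
  (cong (_∧ (y <ᵇ nth U (suc (toℕ k)))) (≤ᵇ≡not<ᵇ (nth U (toℕ k)) y))

module SeparatorProperties {v : ℕ → ℕ} {t n : ℕ} (S : Separator v t n) where

  mono : ∀ {i j} → i ≤ j → j ≤ t → v i ≤ v j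
  mono {j = zero}  z≤n _ = ≤-refl
  mono {i} {suc j} i≤j j<t with m≤n⇒m<n∨m≡n i≤j
  ... | inj₂ refl      = ≤-refl
  ... | inj₁ (s≤s i≤j) = ≤-trans (mono i≤j (<⇒≤ j<t)) (step-≤ S j j<t)

  ≤n : ∀ {i} → i ≤ t → v i ≤ n
  ≤n {i} i≤t = subst (v i ≤_) (last≡n S) (mono i≤t ≤-refl)

  Between⇒<n : ∀ {i x} → i < t → Between v i x → x < n
  Between⇒<n i<t (_ , x<) = <-≤-trans x< (≤n i<t)

  between-below : ∀ x j → j ≤ t → x < v j → Σ ℕ λ i → i < j × Between v i x
  between-below x zero    _   x<v₀ = ⊥-elim (n≮0 (subst (x <_) (first≡0 S) x<v₀))
  between-below x (suc j) j<t x<vⱼ₊₁ with v j ≤? x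
  ... | yes vⱼ≤x = j , ≤-refl , vⱼ≤x , x<vⱼ₊₁
  ... | no  vⱼ≰x with between-below x j (<⇒≤ j<t) (≰⇒> vⱼ≰x)
  ... | i , i<j , b = i , m≤n⇒m≤1+n i<j , b

  between-exists : ∀ x → x < n → Σ ℕ λ i → i < t × Between v i x
  between-exists x x<n = between-below x t ≤-refl (subst (x <_) (sym (last≡n S)) x<n)

  between-< : ∀ {i j x y} → j < t → Between v i x → Between v j y → i < j → x < y
  between-< j<t (_ , x<) (vⱼ≤y , _) i<j = <-≤-trans x< (≤-trans (mono i<j (<⇒≤ j<t)) vⱼ≤y)

  between-unique : ∀ {i j x} → i < t → j < t → Between v i x → Between v j x → i ≡ j
  between-unique {i} {j} i<t j<t bi bj with <-cmp i j
  ... | tri< i<j _ _ = ⊥-elim (<-irrefl refl (between-< j<t bi bj i<j))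
  ... | tri≈ _ i≡j _ = i≡j
  ... | tri> _ _ j<i = ⊥-elim (<-irrefl refl (between-< i<t bj bi j<i))

  between-<⇒≤ : ∀ {i j x y} → i < t → Between v i x → Between v j y → x < y → i ≤ j
  between-<⇒≤ i<t bi bj x<y = ≮⇒≥ (λ j<i → <-asym x<y (between-< i<t bj bi j<i))

module Blocks {t n} (V : Vec ℕ (suc t)) (VS : IsSeparator V n) where
  open SeparatorProperties (IsSeparator⇒Separator V VS)

  private
    between : ∀ {k x} → InBlock V k x → Between (nth V) (toℕ k) x
    between = Equivalence.to (InBlock⇔Between V _ _)

  inBlock⇒<n : ∀ {k x} → InBlock V k x → x < n
  inBlock⇒<n {k} = Between⇒<n (toℕ<n k) ∘ between

  blockOf : ∀ x → x < n → Σ (Fin t) λ k → InBlock V k x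
  blockOf x x<n with between-exists x x<n
  ... | i , i<t , b = fromℕ< i<t ,
    Equivalence.from (InBlock⇔Between V _ x) (subst (λ j → Between (nth V) j x) (sym (toℕ-fromℕ< i<t)) b)

  inBlock-unique : ∀ {k k' x} → InBlock V k x → InBlock V k' x → k ≡ k'
  inBlock-unique {k} {k'} p q = toℕ-injective (between-unique (toℕ<n k) (toℕ<n k') (between p) (between q))

  inBlock-< : ∀ {k k' x y} → InBlock V k x → InBlock V k' y → toℕ k < toℕ k' → x < y
  inBlock-< {k' = k'} p q = between-< (toℕ<n k') (between p) (between q)

  inBlock-<⇒≤ : ∀ {k k' x y} → InBlock V k x → InBlock V k' y → x < y → toℕ k ≤ toℕ k'
  inBlock-<⇒≤ {k} p q = between-<⇒≤ (toℕ<n k) (between p) (between q)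

inBlockᵇ-agree : ∀ {t n n'} (U U' : Vec ℕ (suc t)) → IsSeparator U n → IsSeparator U' n' →
                 ∀ {k x y} → InBlock U k x → InBlock U' k y → ∀ k' → inBlockᵇ U k' x ≡ inBlockᵇ U' k' y
inBlockᵇ-agree U U' US U'S {x = x} {y} p p' k' = T-ext
  (λ q → subst (λ c → InBlock U' c y) (Blocks.inBlock-unique U US p q) p')
  (λ q → subst (λ c → InBlock U c x) (Blocks.inBlock-unique U' U'S p' q) p)

prefixSum : ∀ {t} → (Fin t → ℕ) → ℕ → ℕ
prefixSum {zero}  w _       = 0
prefixSum {suc t} w zero    = 0
prefixSum {suc t} w (suc i) = w fzero + prefixSum (w ∘ fsuc) i

prefixSum-zero : ∀ {t} (w : Fin t → ℕ) → prefixSum w 0 ≡ 0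
prefixSum-zero {zero}  w = refl
prefixSum-zero {suc t} w = refl

prefixSum-suc : ∀ {t} (w : Fin t → ℕ) {i} (i<t : i < t) → prefixSum w (suc i) ≡ prefixSum w i + w (fromℕ< i<t)
prefixSum-suc {suc t} w {zero}  _         = trans (cong (w fzero +_) (prefixSum-zero (w ∘ fsuc))) (+-identityʳ _)
prefixSum-suc {suc t} w {suc i} (s<s i<t) =
  trans (cong (w fzero +_) (prefixSum-suc (w ∘ fsuc) i<t)) (sym (+-assoc (w fzero) _ _))

prefixSum-cong : ∀ {t} {w w' : Fin t → ℕ} → (∀ j → w j ≡ w' j) → ∀ i → prefixSum w i ≡ prefixSum w' i
prefixSum-cong {zero}  _ _       = refl
prefixSum-cong {suc t} _ zero    = refl
prefixSum-cong {suc t} e (suc i) = cong₂ _+_ (e fzero) (prefixSum-cong (e ∘ fsuc) i)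

prefixSum-total : ∀ {t} (w : Fin t → ℕ) → prefixSum w t ≡ sum w
prefixSum-total {zero}  w = refl
prefixSum-total {suc t} w = cong (w fzero +_) (prefixSum-total (w ∘ fsuc))

fromSizes : ∀ {t} → (Fin t → ℕ) → Vec ℕ (suc t)
fromSizes {zero}  w = 0 ∷ []
fromSizes {suc t} w = 0 ∷ V.map (w fzero +_) (fromSizes (w ∘ fsuc))

nth-fromSizes : ∀ {t} (w : Fin t → ℕ) {i} → i ≤ t → nth (fromSizes w) i ≡ prefixSum w i
nth-fromSizes {zero}  w {zero}  _         = refl
nth-fromSizes {suc t} w {zero}  _         = refl
nth-fromSizes {suc t} w {suc i} (s≤s i≤t) =
  trans (nth-map (w fzero +_) (fromSizes (w ∘ fsuc)) (s≤s i≤t)) (cong (w fzero +_) (nth-fromSizes (w ∘ fsuc) i≤t))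

blockSize : ∀ {t} → Vec ℕ (suc t) → Fin t → ℕ
blockSize V j = nth V (suc (toℕ j)) ∸ nth V (toℕ j)

prefixSum-blockSize : ∀ {t n} {V : Vec ℕ (suc t)} → Separator (nth V) t n →
                      ∀ i → i ≤ t → prefixSum (blockSize V) i ≡ nth V i
prefixSum-blockSize {t} S zero    _   = trans (prefixSum-zero {t} _) (sym (first≡0 S))
prefixSum-blockSize {V = V} S (suc i) i<t = begin
  prefixSum (blockSize V) (suc i)                 ≡⟨ prefixSum-suc (blockSize V) i<t ⟩
  prefixSum (blockSize V) i + blockSize V (fromℕ< i<t)
    ≡⟨ cong₂ _+_ (prefixSum-blockSize {V = V} S i (<⇒≤ i<t)) (cong (λ j → nth V (suc j) ∸ nth V j) (toℕ-fromℕ< i<t)) ⟩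
  nth V i + (nth V (suc i) ∸ nth V i)             ≡⟨ m+[n∸m]≡n (step-≤ S i i<t) ⟩
  nth V (suc i)                                   ∎
  where open ≡-Reasoning

-- Block σ j of V becomes block j of the new separator.
permuteBlocks : ∀ {t} → Vec ℕ (suc t) → Permutation′ t → Vec ℕ (suc t)
permuteBlocks V σ = fromSizes (blockSize V ∘ (σ ⟨$⟩ʳ_))

opaque
  relocate : ∀ {t} → Vec ℕ (suc t) → Permutation′ t → ℕ → ℕ
  relocate V σ x with any? (λ k → T? (inBlockᵇ V k x))
  ... | yes (k , _) = nth (permuteBlocks V σ) (toℕ (σ ⟨$⟩ˡ k)) + (x ∸ nth V (toℕ k))
  ... | no  _       = x

module Relocation {t n} (V : Vec ℕ (suc t)) (VS : IsSeparator V n) (σ : Permutation′ t) where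
  open ≡-Reasoning

  private
    S = IsSeparator⇒Separator V VS
    w = blockSize V ∘ (σ ⟨$⟩ʳ_)
    between : ∀ {k x} → InBlock V k x → Between (nth V) (toℕ k) x
    between = Equivalence.to (InBlock⇔Between V _ _)

  V' : Vec ℕ (suc t)
  V' = permuteBlocks V σ

  V'-step : (j : Fin t) → nth V' (suc (toℕ j)) ≡ nth V' (toℕ j) + blockSize V (σ ⟨$⟩ʳ j)
  V'-step j = begin
    nth V' (suc (toℕ j))                  ≡⟨ nth-fromSizes w (toℕ<n j) ⟩
    prefixSum w (suc (toℕ j))             ≡⟨ prefixSum-suc w (toℕ<n j) ⟩
    prefixSum w (toℕ j) + w (fromℕ< _)    ≡⟨ cong₂ _+_ (sym (nth-fromSizes w (<⇒≤ (toℕ<n j)))) (cong w (fromℕ<-toℕ j _)) ⟩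
    nth V' (toℕ j) + w j                  ∎

  V'-sep : IsSeparator V' n
  V'-sep = trans (lookup≡nth V' fzero) (trans (nth-fromSizes w z≤n) (prefixSum-zero w))
         , trans (lookup≡nth V' (fromℕ t)) (begin
             nth V' (toℕ (fromℕ t))  ≡⟨ cong (nth V') (toℕ-fromℕ t) ⟩
             nth V' t                ≡⟨ nth-fromSizes w ≤-refl ⟩
             prefixSum w t           ≡⟨ prefixSum-total w ⟩
             sum w                   ≡⟨ sum-permute (blockSize V) σ ⟨
             sum (blockSize V)       ≡⟨ prefixSum-total (blockSize V) ⟨
             prefixSum (blockSize V) t ≡⟨ prefixSum-blockSize {V = V} S t ≤-refl ⟩
             nth V t                 ≡⟨ last≡n S ⟩
             n                       ∎)
         , λ k → subst₂ _≤_ (sym (trans (lookup≡nth V' (inject₁ k)) (cong (nth V') (toℕ-inject₁ k))))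
                             (sym (lookup≡nth V' (fsuc k)))
                             (subst (nth V' (toℕ k) ≤_) (sym (V'-step k)) (m≤m+n _ _))

  opaque
    unfolding relocate

    relocate-inBlock≡ : ∀ {k x} → InBlock V k x → relocate V σ x ≡ nth V' (toℕ (σ ⟨$⟩ˡ k)) + (x ∸ nth V (toℕ k))
    relocate-inBlock≡ {k} {x} p with any? (λ k → T? (inBlockᵇ V k x))
    ... | no ¬q = ⊥-elim (¬q (k , p))
    ... | yes (k' , q) rewrite Blocks.inBlock-unique V VS q p = refl

  relocate-inBlock : ∀ {k x} → InBlock V k x → InBlock V' (σ ⟨$⟩ˡ k) (relocate V σ x)
  relocate-inBlock {k} {x} p rewrite relocate-inBlock≡ p = Equivalence.from (InBlock⇔Between V' _ _)
    ( m≤m+n _ _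
    , subst (nth V' (toℕ (σ ⟨$⟩ˡ k)) + (x ∸ nth V (toℕ k)) <_)
        (sym (trans (V'-step (σ ⟨$⟩ˡ k)) (cong (λ j → nth V' (toℕ (σ ⟨$⟩ˡ k)) + blockSize V j) (inverseʳ σ))))
        (+-monoʳ-< _ (∸-monoˡ-< (proj₂ b) (proj₁ b))))
    where b = between p

  relocate<n : ∀ {x} → x < n → relocate V σ x < n
  relocate<n {x} x<n = Blocks.inBlock⇒<n V' V'-sep (relocate-inBlock (proj₂ (Blocks.blockOf V VS x x<n)))

  relocate-inBlock⁻¹ : ∀ {c x} → x < n → InBlock V' c (relocate V σ x) → InBlock V (σ ⟨$⟩ʳ c) x
  relocate-inBlock⁻¹ {c} {x} x<n p with Blocks.blockOf V VS x x<n
  ... | k , q rewrite Blocks.inBlock-unique V' V'-sep p (relocate-inBlock q) =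
    subst (λ j → InBlock V j x) (sym (inverseʳ σ)) q

  relocate-<⇔ : ∀ {k x y} → InBlock V k x → InBlock V k y → x < y ⇔ relocate V σ x < relocate V σ y
  relocate-<⇔ {k} {x} {y} p q = mk⇔
    (λ x<y → subst₂ _<_ (sym (relocate-inBlock≡ p)) (sym (relocate-inBlock≡ q))
               (+-monoʳ-< (nth V' (toℕ (σ ⟨$⟩ˡ k))) (∸-monoˡ-< x<y (proj₁ (between p)))))
    (λ lt → ≰⇒> (λ y≤x → <⇒≱
       (+-cancelˡ-< (nth V' (toℕ (σ ⟨$⟩ˡ k))) _ _ (subst₂ _<_ (relocate-inBlock≡ p) (relocate-inBlock≡ q) lt))
       (∸-monoˡ-≤ (nth V (toℕ k)) y≤x)))

  permuteBlocks-inverse : permuteBlocks V' (flip σ) ≡ V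
  permuteBlocks-inverse = nth-ext _ _ λ i i≤t → begin
    nth (permuteBlocks V' (flip σ)) i                     ≡⟨ nth-fromSizes _ (s≤s⁻¹ i≤t) ⟩
    prefixSum (blockSize V' ∘ (σ ⟨$⟩ˡ_)) i               ≡⟨ prefixSum-cong {w' = blockSize V} blockSize-V' i ⟩
    prefixSum (blockSize V) i                             ≡⟨ prefixSum-blockSize {V = V} S i (s≤s⁻¹ i≤t) ⟩
    nth V i                                               ∎
    where
    blockSize-V' : ∀ j → blockSize V' (σ ⟨$⟩ˡ j) ≡ blockSize V j
    blockSize-V' j = trans (cong (_∸ nth V' (toℕ (σ ⟨$⟩ˡ j))) (V'-step (σ ⟨$⟩ˡ j)))
                           (trans (m+n∸m≡n (nth V' (toℕ (σ ⟨$⟩ˡ j))) _) (cong (blockSize V) (inverseʳ σ)))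

relocate-inverse : ∀ {t n} (V : Vec ℕ (suc t)) (VS : IsSeparator V n) (σ : Permutation′ t) →
                   ∀ {x} → x < n → relocate (permuteBlocks V σ) (flip σ) (relocate V σ x) ≡ x
relocate-inverse V VS σ {x} x<n with Blocks.blockOf V VS x x<n
... | k , p = begin
  relocate V' (flip σ) (relocate V σ x)
    ≡⟨ Relocation.relocate-inBlock≡ V' V'-sep (flip σ) (relocate-inBlock p) ⟩
  nth (permuteBlocks V' (flip σ)) (toℕ (σ ⟨$⟩ʳ (σ ⟨$⟩ˡ k))) + (relocate V σ x ∸ nth V' (toℕ (σ ⟨$⟩ˡ k)))
    ≡⟨ cong₂ (λ U j → nth U (toℕ j) + (relocate V σ x ∸ nth V' (toℕ (σ ⟨$⟩ˡ k))))
             permuteBlocks-inverse (inverseʳ σ) ⟩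
  nth V (toℕ k) + (relocate V σ x ∸ nth V' (toℕ (σ ⟨$⟩ˡ k)))
    ≡⟨ cong (λ z → nth V (toℕ k) + (z ∸ nth V' (toℕ (σ ⟨$⟩ˡ k)))) (relocate-inBlock≡ p) ⟩
  nth V (toℕ k) + ((nth V' (toℕ (σ ⟨$⟩ˡ k)) + (x ∸ nth V (toℕ k))) ∸ nth V' (toℕ (σ ⟨$⟩ˡ k)))
    ≡⟨ cong (nth V (toℕ k) +_) (m+n∸m≡n (nth V' (toℕ (σ ⟨$⟩ˡ k))) _) ⟩
  nth V (toℕ k) + (x ∸ nth V (toℕ k))
    ≡⟨ m+[n∸m]≡n (proj₁ (Equivalence.to (InBlock⇔Between V k x) p)) ⟩
  x ∎
  where
  open ≡-Reasoning
  open Relocation V VS σ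

module RelocationPair {t n} (V : Vec ℕ (suc t)) (VS : IsSeparator V n) (σ : Permutation′ t) where
  open Relocation V VS σ public
  private module Back = Relocation V' V'-sep (flip σ)

  back : ℕ → ℕ
  back = relocate V' (flip σ)

  back-inBlock : ∀ {k x} → InBlock V' k x → InBlock V (σ ⟨$⟩ʳ k) (back x)
  back-inBlock {k} {x} p =
    subst (λ U → InBlock U (σ ⟨$⟩ʳ k) (back x)) permuteBlocks-inverse (Back.relocate-inBlock p)

  back-<⇔ : ∀ {k x y} → InBlock V' k x → InBlock V' k y → x < y ⇔ back x < back y
  back-<⇔ = Back.relocate-<⇔

  back<n : ∀ {x} → x < n → back x < n
  back<n = Back.relocate<n

  back-relocate : ∀ {x} → x < n → back (relocate V σ x) ≡ x
  back-relocate = relocate-inverse V VS σ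

  relocate-back : ∀ {x} → x < n → relocate V σ (back x) ≡ x
  relocate-back {x} x<n =
    subst (λ U → relocate U σ (back x) ≡ x) permuteBlocks-inverse (relocate-inverse V' V'-sep (flip σ) x<n)

IsPerm⇒col< : ∀ {π} → IsPerm π → ∀ a → col π a < length π
IsPerm⇒col< (π<n , _) a = All.lookup π<n (∈-lookup a)

fromℕ-or : ∀ {m} → ℕ → Fin m → Fin m
fromℕ-or {m} y d with y <? m
... | yes y<m = fromℕ< y<m
... | no  _   = d

toℕ-fromℕ-or : ∀ {m y} (d : Fin m) → y < m → toℕ (fromℕ-or y d) ≡ y
toℕ-fromℕ-or {m} {y} d y<m with y <? m
... | yes y<m′ = toℕ-fromℕ< y<m′
... | no  y≮m  = ⊥-elim (y≮m y<m)

Unique⇒lookup-injective : ∀ {xs : List ℕ} → Unique xs → ∀ {a b} → L.lookup xs a ≡ L.lookup xs b → a ≡ b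
Unique⇒lookup-injective (_ ∷ _)  {fzero}  {fzero}  _ = refl
Unique⇒lookup-injective (x∉ ∷ _) {fzero}  {fsuc b} e = ⊥-elim (All.lookup x∉ (∈-lookup b) e)
Unique⇒lookup-injective (x∉ ∷ _) {fsuc a} {fzero}  e = ⊥-elim (All.lookup x∉ (∈-lookup a) (sym e))
Unique⇒lookup-injective (_ ∷ u)  {fsuc a} {fsuc b} e = cong fsuc (Unique⇒lookup-injective u e)

lookup-tabulate-cast : ∀ {m} (h : Fin m → ℕ) (a : Fin (length (L.tabulate h))) →
                       L.lookup (L.tabulate h) a ≡ h (cast (LP.length-tabulate h) a)
lookup-tabulate-cast h a =
  trans (cong (L.lookup (L.tabulate h)) (sym (cast-involutive (sym (LP.length-tabulate h)) (LP.length-tabulate h) a)))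
        (LP.lookup-tabulate h (cast (LP.length-tabulate h) a))

-- The fallback a of fromℕ-or is never used: relocation maps [0, length π) into itself.
newCol : ∀ {r s} (π : List ℕ) → Vec ℕ (suc r) → Vec ℕ (suc s) → Permutation′ r → Permutation′ s →
         Fin (length π) → ℕ
newCol π V W σ τ a = relocate W τ (col π (fromℕ-or (relocate (permuteBlocks V σ) (flip σ) (toℕ a)) a))

newPerm : ∀ {r s} (π : List ℕ) → Vec ℕ (suc r) → Vec ℕ (suc s) → Permutation′ r → Permutation′ s → List ℕ
newPerm π V W σ τ = L.tabulate (newCol π V W σ τ)

module Reindex {r s} {M : Matrix r s} (σ : Permutation′ r) (τ : Permutation′ s) (x : Part M) where
  open ≡-Reasoning

  π = perm x
  n = length π
  module R = RelocationPair (I x) (I-sep x) σ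
  module C = RelocationPair (J x) (J-sep x) τ

  I' = R.V'
  J' = C.V'

  π' : List ℕ
  π' = newPerm π (I x) (J x) σ τ

  n' = length π'

  n'≡n : n' ≡ n
  n'≡n = LP.length-tabulate (newCol π (I x) (J x) σ τ)

  col<n : ∀ a → col π a < n
  col<n = IsPerm⇒col< (isPerm x)

  source : Fin n' → Fin n
  source a = fromℕ-or (R.back (toℕ (cast n'≡n a))) (cast n'≡n a)

  row<n : (a : Fin n') → toℕ a < n
  row<n a = subst (toℕ a <_) n'≡n (toℕ<n a)

  toℕ-source : ∀ a → toℕ (source a) ≡ R.back (toℕ a)
  toℕ-source a = trans (toℕ-fromℕ-or _ (R.back<n (toℕ<n (cast n'≡n a))))
                       (cong R.back (toℕ-cast n'≡n a))

  col-π' : ∀ a → col π' a ≡ relocate (J x) τ (col π (source a))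
  col-π' = lookup-tabulate-cast (newCol π (I x) (J x) σ τ)

  target : Fin n → Fin n'
  target a = cast (sym n'≡n) (fromℕ-or (relocate (I x) σ (toℕ a)) a)

  toℕ-target : ∀ a → toℕ (target a) ≡ relocate (I x) σ (toℕ a)
  toℕ-target a = trans (toℕ-cast (sym n'≡n) _) (toℕ-fromℕ-or a (R.relocate<n (toℕ<n a)))

  source-target : ∀ a → source (target a) ≡ a
  source-target a = toℕ-injective (begin
    toℕ (source (target a))          ≡⟨ toℕ-source (target a) ⟩
    R.back (toℕ (target a))          ≡⟨ cong R.back (toℕ-target a) ⟩
    R.back (relocate (I x) σ (toℕ a)) ≡⟨ R.back-relocate (toℕ<n a) ⟩
    toℕ a                            ∎)

  source-inBlock : ∀ {k a} → InBlock I' k (toℕ a) → InBlock (I x) (σ ⟨$⟩ʳ k) (toℕ (source a))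
  source-inBlock {a = a} p = subst (InBlock (I x) _) (sym (toℕ-source a)) (R.back-inBlock p)

  source-<⇔ : ∀ {k a b} → InBlock I' k (toℕ a) → InBlock I' k (toℕ b) →
              toℕ a < toℕ b ⇔ toℕ (source a) < toℕ (source b)
  source-<⇔ {a = a} {b} p q =
    subst₂ (λ u v → toℕ a < toℕ b ⇔ u < v) (sym (toℕ-source a)) (sym (toℕ-source b)) (R.back-<⇔ p q)

  target-inBlock : ∀ {k a} → InBlock (I x) k (toℕ a) → InBlock I' (σ ⟨$⟩ˡ k) (toℕ (target a))
  target-inBlock {a = a} p = subst (InBlock I' _) (sym (toℕ-target a)) (R.relocate-inBlock p)

  target-<⇔ : ∀ {k a b} → InBlock (I x) k (toℕ a) → InBlock (I x) k (toℕ b) →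
              toℕ a < toℕ b ⇔ toℕ (target a) < toℕ (target b)
  target-<⇔ {a = a} {b} p q =
    subst₂ (λ u v → toℕ a < toℕ b ⇔ u < v) (sym (toℕ-target a)) (sym (toℕ-target b)) (R.relocate-<⇔ p q)

  col-inBlock⁻¹ : ∀ {l a} → InBlock J' l (col π' a) → InBlock (J x) (τ ⟨$⟩ʳ l) (col π (source a))
  col-inBlock⁻¹ {a = a} p = C.relocate-inBlock⁻¹ (col<n _) (subst (InBlock J' _) (col-π' a) p)

  I'-sep : IsSeparator I' n'
  I'-sep = subst (IsSeparator I') (sym n'≡n) R.V'-sep

  J'-sep : IsSeparator J' n'
  J'-sep = subst (IsSeparator J') (sym n'≡n) C.V'-sep

  isPerm' : IsPerm π'
  isPerm' = AllP.tabulate⁺ (λ a → subst (newCol π (I x) (J x) σ τ a <_) (sym n'≡n) (C.relocate<n (col<n _)))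
          , UniqueP.tabulate⁺ newCol-injective
    where
    newCol-injective : ∀ {a b} → newCol π (I x) (J x) σ τ a ≡ newCol π (I x) (J x) σ τ b → a ≡ b
    newCol-injective {a} {b} e = toℕ-injective (begin
      toℕ a                                            ≡⟨ R.relocate-back (toℕ<n a) ⟨
      relocate (I x) σ (R.back (toℕ a))                ≡⟨ cong (relocate (I x) σ) (toℕ-fromℕ-or a (R.back<n (toℕ<n a))) ⟨
      relocate (I x) σ (toℕ (fromℕ-or _ a))            ≡⟨ cong (relocate (I x) σ ∘ toℕ) same-row ⟩
      relocate (I x) σ (toℕ (fromℕ-or _ b))            ≡⟨ cong (relocate (I x) σ) (toℕ-fromℕ-or b (R.back<n (toℕ<n b))) ⟩
      relocate (I x) σ (R.back (toℕ b))                ≡⟨ R.relocate-back (toℕ<n b) ⟩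
      toℕ b                                            ∎)
      where
      same-row = Unique⇒lookup-injective (proj₂ (isPerm x))
        (trans (sym (C.back-relocate (col<n _))) (trans (cong C.back e) (C.back-relocate (col<n _))))

  blocks' : ∀ e k l → BlockOK e π (I x) (J x) (σ ⟨$⟩ʳ k) (τ ⟨$⟩ʳ l) → BlockOK e π' I' J' k l
  blocks' e0  k l ok a p q = ok (source a) (source-inBlock p) (col-inBlock⁻¹ q)
  blocks' e+1 k l ok a b a<b pa pb qa qb =
    subst₂ _<_ (sym (col-π' a)) (sym (col-π' b))
      (Equivalence.to (C.relocate-<⇔ (col-inBlock⁻¹ qa) (col-inBlock⁻¹ qb))
        (ok _ _ (Equivalence.to (source-<⇔ pa pb) a<b) (source-inBlock pa) (source-inBlock pb)
                (col-inBlock⁻¹ qa) (col-inBlock⁻¹ qb)))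
  blocks' e-1 k l ok a b a<b pa pb qa qb =
    subst₂ _<_ (sym (col-π' b)) (sym (col-π' a))
      (Equivalence.to (C.relocate-<⇔ (col-inBlock⁻¹ qb) (col-inBlock⁻¹ qa))
        (ok _ _ (Equivalence.to (source-<⇔ pa pb) a<b) (source-inBlock pa) (source-inBlock pb)
                (col-inBlock⁻¹ qa) (col-inBlock⁻¹ qb)))

reindex : ∀ {r s} {M M' : Matrix r s} (σ : Permutation′ r) (τ : Permutation′ s) →
          (∀ i j → M' i j ≡ M (σ ⟨$⟩ʳ i) (τ ⟨$⟩ʳ j)) → Part M → Part M'
reindex {M = M} σ τ M'≡M x = record
  { perm   = π'
  ; isPerm = isPerm'
  ; I      = I'
  ; J      = J'
  ; I-sep  = I'-sep
  ; J-sep  = J'-sep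
  ; blocks = λ k l → subst (λ e → BlockOK e π' I' J' k l) (sym (M'≡M k l))
                           (blocks' (M (σ ⟨$⟩ʳ k) (τ ⟨$⟩ʳ l)) k l (blocks x (σ ⟨$⟩ʳ k) (τ ⟨$⟩ʳ l)))
  }
  where open Reindex σ τ x

tabulate-cong-cast : ∀ {m k} (eq : m ≡ k) (u : Fin m → ℕ) (v : Fin k → ℕ) → (∀ a → u a ≡ v (cast eq a)) →
                     L.tabulate u ≡ L.tabulate v
tabulate-cong-cast refl u v u≡v = LP.tabulate-cong (λ a → trans (u≡v a) (cong v (cast-is-id refl a)))

module ReindexInverse {r s} {M : Matrix r s} (σ : Permutation′ r) (τ : Permutation′ s) (x : Part M) where
  open Reindex σ τ x
  open ≡-Reasoning

  newCol-inverse : ∀ a → newCol π' I' J' (flip σ) (flip τ) a ≡ col π (cast n'≡n a)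
  newCol-inverse a = begin
    relocate J' (flip τ) (col π' (fromℕ-or (relocate (permuteBlocks I' (flip σ)) σ (toℕ a)) a))
      ≡⟨ cong (relocate J' (flip τ) ∘ col π') source-row ⟩
    relocate J' (flip τ) (col π' (target (cast n'≡n a)))
      ≡⟨ cong (relocate J' (flip τ)) (col-π' _) ⟩
    C.back (relocate (J x) τ (col π (source (target (cast n'≡n a)))))
      ≡⟨ cong (λ b → C.back (relocate (J x) τ (col π b))) (source-target _) ⟩
    C.back (relocate (J x) τ (col π (cast n'≡n a)))
      ≡⟨ C.back-relocate (col<n _) ⟩
    col π (cast n'≡n a) ∎
    where
    source-row : fromℕ-or (relocate (permuteBlocks I' (flip σ)) σ (toℕ a)) a ≡ target (cast n'≡n a)
    source-row = toℕ-injective (begin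
      toℕ (fromℕ-or (relocate (permuteBlocks I' (flip σ)) σ (toℕ a)) a)
        ≡⟨ cong (λ U → toℕ (fromℕ-or (relocate U σ (toℕ a)) a)) R.permuteBlocks-inverse ⟩
      toℕ (fromℕ-or (relocate (I x) σ (toℕ a)) a)
        ≡⟨ toℕ-fromℕ-or a (subst (relocate (I x) σ (toℕ a) <_) (sym n'≡n) (R.relocate<n (row<n a))) ⟩
      relocate (I x) σ (toℕ a)
        ≡⟨ cong (relocate (I x) σ) (toℕ-cast n'≡n a) ⟨
      relocate (I x) σ (toℕ (cast n'≡n a))
        ≡⟨ toℕ-target _ ⟨
      toℕ (target (cast n'≡n a)) ∎)

  newPerm-inverse : newPerm π' I' J' (flip σ) (flip τ) ≡ π
  newPerm-inverse = trans (tabulate-cong-cast n'≡n _ (L.lookup π) newCol-inverse) (LP.tabulate-lookup π)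

inverse-hypothesis : ∀ {r s} {M M' : Matrix r s} (σ : Permutation′ r) (τ : Permutation′ s) →
                     (∀ i j → M' i j ≡ M (σ ⟨$⟩ʳ i) (τ ⟨$⟩ʳ j)) →
                     (∀ i j → M i j ≡ M' (flip σ ⟨$⟩ʳ i) (flip τ ⟨$⟩ʳ j))
inverse-hypothesis {M = M} σ τ M'≡M i j =
  trans (cong₂ M (sym (inverseʳ σ)) (sym (inverseʳ τ))) (sym (M'≡M _ _))

reindex-inverse : ∀ {r s} {M M' : Matrix r s} (σ : Permutation′ r) (τ : Permutation′ s)
                  (M'≡M : ∀ i j → M' i j ≡ M (σ ⟨$⟩ʳ i) (τ ⟨$⟩ʳ j))
                  (M≡M' : ∀ i j → M i j ≡ M' (flip σ ⟨$⟩ʳ i) (flip τ ⟨$⟩ʳ j)) →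
                  ∀ x → reindex (flip σ) (flip τ) M≡M' (reindex σ τ M'≡M x) ≈ x
reindex-inverse σ τ _ _ x = newPerm-inverse , R.permuteBlocks-inverse , C.permuteBlocks-inverse
  where open ReindexInverse σ τ x
        open Reindex σ τ x

reindex-cong : ∀ {r s} {M M' : Matrix r s} (σ : Permutation′ r) (τ : Permutation′ s)
               (M'≡M : ∀ i j → M' i j ≡ M (σ ⟨$⟩ʳ i) (τ ⟨$⟩ʳ j)) →
               ∀ {x y : Part M} → x ≈ y → reindex σ τ M'≡M x ≈ reindex σ τ M'≡M y
reindex-cong σ τ _ (π≡ , I≡ , J≡) =
    cong₂ (λ π (V , W) → newPerm π V W σ τ) π≡ (cong₂ _,_ I≡ J≡)
  , cong (λ V → permuteBlocks V σ) I≡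
  , cong (λ W → permuteBlocks W τ) J≡

countBelow : ∀ {m t} → (Fin m → Bool) → (Fin m → ℕ) → Vec ℕ (suc t) → ℕ → ℕ
countBelow f y U j = count (λ a → f a ∧ (y a <ᵇ nth U j))

countIn : ∀ {m t} → (Fin m → Bool) → (Fin m → ℕ) → Vec ℕ (suc t) → Fin t → ℕ
countIn f y U k = count (λ a → f a ∧ inBlockᵇ U k (y a))

countBelow-zero : ∀ {m t} (f : Fin m → Bool) (y : Fin m → ℕ) (U : Vec ℕ (suc t)) → nth U 0 ≡ 0 →
                  countBelow f y U 0 ≡ 0
countBelow-zero f y U U₀≡0 = count-≡0 _ (λ a p → n≮0 (subst (y a <_) U₀≡0 (<ᵇ⇒< (y a) _ (∧-elimʳ {f a} p))))

countBelow-suc : ∀ {m t} (f : Fin m → Bool) (y : Fin m → ℕ) (U : Vec ℕ (suc t)) (k : Fin t) {j} → toℕ k ≡ j →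
                 nth U j ≤ nth U (suc j) → countBelow f y U (suc j) ≡ countBelow f y U j + countIn f y U k
countBelow-suc f y U k refl step =
  trans (count-split _ (λ a → y a <ᵇ nth U (toℕ k))) (cong₂ _+_ (count-cong below) (count-cong inside))
  where
  below : ∀ a → (f a ∧ (y a <ᵇ nth U (suc (toℕ k)))) ∧ (y a <ᵇ nth U (toℕ k)) ≡ f a ∧ (y a <ᵇ nth U (toℕ k))
  below a = trans (∧-assoc (f a) _ _)
                  (cong (f a ∧_) (∧-≡ʳ (λ p → <⇒<ᵇ (<-≤-trans (<ᵇ⇒< (y a) _ p) step))))
  inside : ∀ a → (f a ∧ (y a <ᵇ nth U (suc (toℕ k)))) ∧ not (y a <ᵇ nth U (toℕ k)) ≡ f a ∧ inBlockᵇ U k (y a)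
  inside a = trans (∧-assoc (f a) _ _)
                   (cong (f a ∧_) (trans (∧-comm (y a <ᵇ nth U (suc (toℕ k))) _) (sym (inBlockᵇ≡ U k (y a)))))

countBelow-all : ∀ {m t N} (f : Fin m → Bool) (y : Fin m → ℕ) (U : Vec ℕ (suc t)) → nth U t ≡ N →
                 (∀ a → y a < N) → countBelow f y U t ≡ count f
countBelow-all f y U Uₜ≡N y<N = count-cong λ a →
  trans (cong (f a ∧_) (Equivalence.to T-≡ (<⇒<ᵇ (subst (y a <_) (sym Uₜ≡N) (y<N a))))) (∧-identityʳ (f a))

countIn≡⇒countBelow≡ : ∀ {m t N₁ N₂} (f₁ f₂ : Fin m → Bool) (y₁ y₂ : Fin m → ℕ) (U₁ U₂ : Vec ℕ (suc t)) →
                       IsSeparator U₁ N₁ → IsSeparator U₂ N₂ →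
                       (∀ k → countIn f₁ y₁ U₁ k ≡ countIn f₂ y₂ U₂ k) →
                       ∀ j → j ≤ t → countBelow f₁ y₁ U₁ j ≡ countBelow f₂ y₂ U₂ j
countIn≡⇒countBelow≡ f₁ f₂ y₁ y₂ U₁ U₂ U₁S U₂S counts = go
  where
  S₁ = IsSeparator⇒Separator U₁ U₁S
  S₂ = IsSeparator⇒Separator U₂ U₂S
  go : ∀ j → _ → countBelow f₁ y₁ U₁ j ≡ countBelow f₂ y₂ U₂ j
  go zero    _   = trans (countBelow-zero f₁ y₁ U₁ (first≡0 S₁)) (sym (countBelow-zero f₂ y₂ U₂ (first≡0 S₂)))
  go (suc j) j<t = begin
    countBelow f₁ y₁ U₁ (suc j)                 ≡⟨ countBelow-suc f₁ y₁ U₁ k (toℕ-fromℕ< j<t) (step-≤ S₁ j j<t) ⟩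
    countBelow f₁ y₁ U₁ j + countIn f₁ y₁ U₁ k  ≡⟨ cong₂ _+_ (go j (<⇒≤ j<t)) (counts k) ⟩
    countBelow f₂ y₂ U₂ j + countIn f₂ y₂ U₂ k  ≡⟨ countBelow-suc f₂ y₂ U₂ k (toℕ-fromℕ< j<t) (step-≤ S₂ j j<t) ⟨
    countBelow f₂ y₂ U₂ (suc j)                 ∎
    where
    open ≡-Reasoning
    k = fromℕ< j<t

belowCounts⇒inBlockᵇ≡ : ∀ {m t} (g : Fin m → ℕ) → (∀ {a b} → g a ≡ g b → a ≡ b) →
                        (y₁ y₂ : Fin m → ℕ) → (∀ a b → g a < g b → y₁ a < y₁ b) → (∀ a b → g a < g b → y₂ a < y₂ b) →
                        (V₁ V₂ : Vec ℕ (suc t)) →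
                        (∀ i → i ≤ t → count (λ a → y₁ a <ᵇ nth V₁ i) ≡ count (λ a → y₂ a <ᵇ nth V₂ i)) →
                        ∀ a k → inBlockᵇ V₁ k (y₁ a) ≡ inBlockᵇ V₂ k (y₂ a)
belowCounts⇒inBlockᵇ≡ g g-inj y₁ y₂ y₁-mono y₂-mono V₁ V₂ counts a k =
  trans (inBlockᵇ≡ V₁ k (y₁ a))
    (trans (cong₂ (λ u v → not u ∧ v) (below≡ (toℕ k) (<⇒≤ (toℕ<n k))) (below≡ (suc (toℕ k)) (toℕ<n k)))
           (sym (inBlockᵇ≡ V₂ k (y₂ a))))
  where
  below≡ : ∀ i → i ≤ _ → (y₁ a <ᵇ nth V₁ i) ≡ (y₂ a <ᵇ nth V₂ i)
  below≡ i i≤t = downClosed-count-≡⇒≡ g g-inj (λ a → y₁ a <ᵇ nth V₁ i) (λ a → y₂ a <ᵇ nth V₂ i)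
    (λ a b ga<gb p → <⇒<ᵇ (<-trans (y₁-mono a b ga<gb) (<ᵇ⇒< (y₁ b) (nth V₁ i) p)))
    (λ a b ga<gb p → <⇒<ᵇ (<-trans (y₂-mono a b ga<gb) (<ᵇ⇒< (y₂ b) (nth V₂ i) p)))
    (counts i i≤t) a

StrictlyIncreasing⇒<⇔ : ∀ {m n} {e : Fin m → Fin n} → StrictlyIncreasing e →
                        ∀ a b → toℕ a < toℕ b ⇔ toℕ (e a) < toℕ (e b)
StrictlyIncreasing⇒<⇔ {e = e} e-inc a b = mk⇔ (e-inc a b) reflect
  where
  reflect : toℕ (e a) < toℕ (e b) → toℕ a < toℕ b
  reflect ea<eb with <-cmp (toℕ a) (toℕ b)
  ... | tri< a<b _ _ = a<b
  ... | tri≈ _ a≡b _ = ⊥-elim (<-irrefl (cong (toℕ ∘ e) (toℕ-injective a≡b)) ea<eb)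
  ... | tri> _ _ b<a = ⊥-elim (<-asym ea<eb (e-inc b a b<a))

module Embedding {r s} {M : Matrix r s} (x' x : Part M) (w : x' ⪯ x) where
  π₁ = perm x'
  π = perm x

  e : Fin (length π₁) → Fin (length π)
  e = proj₁ w

  e-<⇔ : ∀ a b → toℕ a < toℕ b ⇔ toℕ (e a) < toℕ (e b)
  e-<⇔ = StrictlyIncreasing⇒<⇔ (proj₁ (proj₂ w))

  e-col⇔ : ∀ a b → col π₁ a < col π₁ b ⇔ col π (e a) < col π (e b)
  e-col⇔ = proj₁ (proj₂ (proj₂ w))

  private
    counts : ∀ k l → countIn (λ a → inBlockᵇ (I x) k (toℕ (e a))) (col π ∘ e) (J x) l
                   ≡ countIn (λ a → inBlockᵇ (I x') k (toℕ a)) (col π₁) (J x') l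
    counts = proj₂ (proj₂ (proj₂ w))
    allRows : Fin (length π₁) → Bool
    allRows _ = true
    last : ∀ {t n} (V : Vec ℕ (suc t)) → IsSeparator V n → nth V t ≡ n
    last V VS = last≡n (IsSeparator⇒Separator V VS)

  rowCounts : ∀ k → count (λ a → inBlockᵇ (I x) k (toℕ (e a))) ≡ count {length π₁} (λ a → inBlockᵇ (I x') k (toℕ a))
  rowCounts k = begin
    count f₁
      ≡⟨ countBelow-all f₁ (col π ∘ e) (J x) (last (J x) (J-sep x)) (IsPerm⇒col< (isPerm x) ∘ e) ⟨
    countBelow f₁ (col π ∘ e) (J x) s
      ≡⟨ countIn≡⇒countBelow≡ f₁ f₂ (col π ∘ e) (col π₁) (J x) (J x') (J-sep x) (J-sep x') (counts k) s ≤-refl ⟩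
    countBelow f₂ (col π₁) (J x') s
      ≡⟨ countBelow-all f₂ (col π₁) (J x') (last (J x') (J-sep x')) (IsPerm⇒col< (isPerm x')) ⟩
    count f₂ ∎
    where
    open ≡-Reasoning
    f₁ f₂ : Fin (length π₁) → Bool
    f₁ a = inBlockᵇ (I x) k (toℕ (e a))
    f₂ a = inBlockᵇ (I x') k (toℕ a)

  colCounts : ∀ l → count (λ a → inBlockᵇ (J x) l (col π (e a))) ≡ count (λ a → inBlockᵇ (J x') l (col π₁ a))
  colCounts l = begin
    count f₁
      ≡⟨ countBelow-all f₁ (toℕ ∘ e) (I x) (last (I x) (I-sep x)) (toℕ<n ∘ e) ⟨
    countBelow f₁ (toℕ ∘ e) (I x) r
      ≡⟨ countIn≡⇒countBelow≡ f₁ f₂ (toℕ ∘ e) toℕ (I x) (I x') (I-sep x) (I-sep x') swapped r ≤-refl ⟩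
    countBelow f₂ toℕ (I x') r
      ≡⟨ countBelow-all f₂ toℕ (I x') (last (I x') (I-sep x')) toℕ<n ⟩
    count f₂ ∎
    where
    open ≡-Reasoning
    f₁ f₂ : Fin (length π₁) → Bool
    f₁ a = inBlockᵇ (J x) l (col π (e a))
    f₂ a = inBlockᵇ (J x') l (col π₁ a)
    swapped : ∀ k → countIn f₁ (toℕ ∘ e) (I x) k ≡ countIn f₂ toℕ (I x') k
    swapped k = trans (count-cong (λ a → ∧-comm (f₁ a) _)) (trans (counts k l) (count-cong (λ a → ∧-comm _ (f₂ a))))

  rowBlocks : ∀ a k → inBlockᵇ (I x) k (toℕ (e a)) ≡ inBlockᵇ (I x') k (toℕ a)
  rowBlocks = belowCounts⇒inBlockᵇ≡ toℕ toℕ-injective (toℕ ∘ e) toℕ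
    (λ a b → Equivalence.to (e-<⇔ a b)) (λ _ _ → id)
    (I x) (I x') (countIn≡⇒countBelow≡ allRows allRows (toℕ ∘ e) toℕ (I x) (I x') (I-sep x) (I-sep x') rowCounts)

  colBlocks : ∀ a l → inBlockᵇ (J x) l (col π (e a)) ≡ inBlockᵇ (J x') l (col π₁ a)
  colBlocks = belowCounts⇒inBlockᵇ≡ (col π₁) (Unique⇒lookup-injective (proj₂ (isPerm x'))) (col π ∘ e) (col π₁)
    (λ a b → Equivalence.to (e-col⇔ a b)) (λ _ _ → id)
    (J x) (J x')
    (countIn≡⇒countBelow≡ allRows allRows (col π ∘ e) (col π₁) (J x) (J x') (J-sep x) (J-sep x') colCounts)

blockwise-<⇔ : ∀ {A : Set} {t n₁ n₂} (V₁ V₂ : Vec ℕ (suc t)) → IsSeparator V₁ n₁ → IsSeparator V₂ n₂ →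
               (y₁ y₂ : A → ℕ) → (∀ a → y₁ a < n₁) →
               (∀ {k} a → InBlock V₁ k (y₁ a) → InBlock V₂ k (y₂ a)) →
               (∀ {k} a b → InBlock V₁ k (y₁ a) → InBlock V₁ k (y₁ b) → y₁ a < y₁ b ⇔ y₂ a < y₂ b) →
               ∀ a b → y₁ a < y₁ b ⇔ y₂ a < y₂ b
blockwise-<⇔ V₁ V₂ V₁S V₂S y₁ y₂ y₁<n preserve within a b
  with Blocks.blockOf V₁ V₁S (y₁ a) (y₁<n a) | Blocks.blockOf V₁ V₁S (y₁ b) (y₁<n b)
... | ka , pa | kb , pb with ka ≟ kb
...   | yes refl = within a b pa pb
...   | no ka≢kb = mk⇔
  (λ lt → Blocks.inBlock-< V₂ V₂S qa qb (≤∧≢⇒< (Blocks.inBlock-<⇒≤ V₁ V₁S pa pb lt) (ka≢kb ∘ toℕ-injective)))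
  (λ lt → Blocks.inBlock-< V₁ V₁S pa pb (≤∧≢⇒< (Blocks.inBlock-<⇒≤ V₂ V₂S qa qb lt) (ka≢kb ∘ toℕ-injective)))
  where
  qa = preserve a pa
  qb = preserve b pb

module ReindexMono {r s} {M : Matrix r s} (σ : Permutation′ r) (τ : Permutation′ s) (x' x : Part M) (w : x' ⪯ x) where
  open Embedding x' x w
  private
    module X  = Reindex σ τ x
    module X' = Reindex σ τ x'

  E : Fin X'.n' → Fin X.n'
  E = X.target ∘ e ∘ X'.source

  col-E : ∀ a → col X.π' (E a) ≡ relocate (J x) τ (col π (e (X'.source a)))
  col-E a = trans (X.col-π' (E a)) (cong (λ b → relocate (J x) τ (col π b)) (X.source-target _))

  row-inBlock : ∀ {k} a → InBlock X'.I' k (toℕ a) → InBlock X.I' k (toℕ (E a))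
  row-inBlock {k} a p = subst (λ c → InBlock X.I' c (toℕ (E a))) (inverseˡ σ)
    (X.target-inBlock (subst T (sym (rowBlocks _ (σ ⟨$⟩ʳ k))) (X'.source-inBlock p)))

  row-<⇔ : ∀ {k} a b → InBlock X'.I' k (toℕ a) → InBlock X'.I' k (toℕ b) → toℕ a < toℕ b ⇔ toℕ (E a) < toℕ (E b)
  row-<⇔ {k} a b p q =
    ⇔-trans (X'.source-<⇔ p q) (⇔-trans (e-<⇔ _ _) (X.target-<⇔ (source-e-inBlock a p) (source-e-inBlock b q)))
    where
    source-e-inBlock : ∀ c → InBlock X'.I' k (toℕ c) → InBlock (I x) (σ ⟨$⟩ʳ k) (toℕ (e (X'.source c)))
    source-e-inBlock c p = subst T (sym (rowBlocks _ (σ ⟨$⟩ʳ k))) (X'.source-inBlock p)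

  col-inBlock : ∀ {l} a → InBlock X'.J' l (col X'.π' a) → InBlock X.J' l (col X.π' (E a))
  col-inBlock {l} a p = subst₂ (λ c z → InBlock X.J' c z) (inverseˡ τ) (sym (col-E a))
    (X.C.relocate-inBlock (subst T (sym (colBlocks _ (τ ⟨$⟩ʳ l))) (X'.col-inBlock⁻¹ p)))

  col-<⇔ : ∀ {l} a b → InBlock X'.J' l (col X'.π' a) → InBlock X'.J' l (col X'.π' b) →
           col X'.π' a < col X'.π' b ⇔ col X.π' (E a) < col X.π' (E b)
  col-<⇔ {l} a b p q =
    subst₂ (λ u v → u < v ⇔ col X.π' (E a) < col X.π' (E b)) (sym (X'.col-π' a)) (sym (X'.col-π' b))
    (subst₂ (λ u v → _ ⇔ u < v) (sym (col-E a)) (sym (col-E b))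
      (⇔-trans (⇔-sym (X'.C.relocate-<⇔ (X'.col-inBlock⁻¹ p) (X'.col-inBlock⁻¹ q)))
        (⇔-trans (e-col⇔ _ _) (X.C.relocate-<⇔ (e-inBlock a p) (e-inBlock b q)))))
    where
    e-inBlock : ∀ c → InBlock X'.J' l (col X'.π' c) → InBlock (J x) (τ ⟨$⟩ʳ l) (col π (e (X'.source c)))
    e-inBlock c p = subst T (sym (colBlocks _ (τ ⟨$⟩ʳ l))) (X'.col-inBlock⁻¹ p)

  E-strictlyIncreasing : StrictlyIncreasing E
  E-strictlyIncreasing a b = Equivalence.to
    (blockwise-<⇔ X'.I' X.I' X'.I'-sep X.I'-sep toℕ (toℕ ∘ E) toℕ<n row-inBlock row-<⇔ a b)

  E-col⇔ : ∀ a b → col X'.π' a < col X'.π' b ⇔ col X.π' (E a) < col X.π' (E b)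
  E-col⇔ = blockwise-<⇔ X'.J' X.J' X'.J'-sep X.J'-sep (col X'.π') (col X.π' ∘ E) (IsPerm⇒col< X'.isPerm')
                        col-inBlock col-<⇔

  E-counts : ∀ k l → count (λ a → inBlockᵇ X.I' k (toℕ (E a)) ∧ inBlockᵇ X.J' l (col X.π' (E a)))
                   ≡ count (λ a → inBlockᵇ X'.I' k (toℕ a) ∧ inBlockᵇ X'.J' l (col X'.π' a))
  E-counts k l = count-cong λ a →
    let (k₀ , p) = Blocks.blockOf X'.I' X'.I'-sep (toℕ a) (toℕ<n a)
        (l₀ , q) = Blocks.blockOf X'.J' X'.J'-sep _ (IsPerm⇒col< X'.isPerm' a)
    in cong₂ _∧_ (inBlockᵇ-agree X.I' X'.I' X.I'-sep X'.I'-sep (row-inBlock a p) p k)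
                 (inBlockᵇ-agree X.J' X'.J' X.J'-sep X'.J'-sep (col-inBlock a q) q l)

reindex-mono : ∀ {r s} {M M' : Matrix r s} (σ : Permutation′ r) (τ : Permutation′ s)
               (M'≡M : ∀ i j → M' i j ≡ M (σ ⟨$⟩ʳ i) (τ ⟨$⟩ʳ j)) →
               ∀ (x' x : Part M) → x' ⪯ x → reindex σ τ M'≡M x' ⪯ reindex σ τ M'≡M x
reindex-mono σ τ _ x' x w = E , E-strictlyIncreasing , E-col⇔ , E-counts
  where open ReindexMono σ τ x' x w

-- x' ⪯ x unfolds definitionally to Embeds (perm x') (I x') (J x') (perm x) (I x) (J x).
Embeds : ∀ {r s} → List ℕ → Vec ℕ (suc r) → Vec ℕ (suc s) → List ℕ → Vec ℕ (suc r) → Vec ℕ (suc s) → Set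
Embeds {r} {s} π₁ I₁ J₁ π I J =
  Σ (Fin (length π₁) → Fin (length π)) λ e →
    StrictlyIncreasing e ×
    ((a b : Fin (length π₁)) → (col π₁ a < col π₁ b) ⇔ (col π (e a) < col π (e b))) ×
    ((k : Fin r) (l : Fin s) →
       count (λ a → inBlockᵇ I k (toℕ (e a)) ∧ inBlockᵇ J l (col π (e a)))
       ≡ count (λ a → inBlockᵇ I₁ k (toℕ a) ∧ inBlockᵇ J₁ l (col π₁ a)))

Embeds-resp : ∀ {r s} {π₁ π₁' π π' : List ℕ} {I₁ I₁' I I' : Vec ℕ (suc r)} {J₁ J₁' J J' : Vec ℕ (suc s)} →
              π₁ ≡ π₁' → I₁ ≡ I₁' → J₁ ≡ J₁' → π ≡ π' → I ≡ I' → J ≡ J' →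
              Embeds π₁ I₁ J₁ π I J → Embeds π₁' I₁' J₁' π' I' J'
Embeds-resp refl refl refl refl refl refl w = w

⪯-resp : ∀ {r s} {M : Matrix r s} {x₁ x₂ y₁ y₂ : Part M} → x₁ ≈ x₂ → y₁ ≈ y₂ → x₁ ⪯ y₁ → x₂ ⪯ y₂
⪯-resp (π≡ , I≡ , J≡) (π'≡ , I'≡ , J'≡) = Embeds-resp π≡ I≡ J≡ π'≡ I'≡ J'≡

proposition3p2 : ∀ {r s} (M M' : Matrix r s) (σ : Permutation′ r) (τ : Permutation′ s) →
                   (∀ i j → M' i j ≡ M (σ ⟨$⟩ʳ i) (τ ⟨$⟩ʳ j)) →
                   PosetIso M M'
proposition3p2 M M' σ τ M'≡M = record
  { to        = to
  ; from      = from
  ; to-cong   = λ {x} {y} → reindex-cong σ τ M'≡M {x} {y}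
  ; from-cong = λ {x} {y} → reindex-cong (flip σ) (flip τ) M≡M' {x} {y}
  ; from-to   = from-to
  ; to-from   = reindex-inverse {M = M'} (flip σ) (flip τ) M≡M' M'≡M
  ; to-mono   = reindex-mono {M = M} σ τ M'≡M
  ; to-refl   = λ x y w → ⪯-resp {x₁ = from (to x)} {x} {from (to y)} {y} (from-to x) (from-to y)
                                  (reindex-mono {M = M'} (flip σ) (flip τ) M≡M' (to x) (to y) w)
  }
  where
  M≡M' : ∀ i j → M i j ≡ M' (flip σ ⟨$⟩ʳ i) (flip τ ⟨$⟩ʳ j)
  M≡M' = inverse-hypothesis σ τ M'≡M
  to : Part M → Part M'
  to = reindex σ τ M'≡M
  from : Part M' → Part M
  from = reindex (flip σ) (flip τ) M≡M'
  from-to : ∀ x → from (to x) ≈ x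
  from-to = reindex-inverse {M = M} σ τ M'≡M M≡M'
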